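{- Let $p\equiv 1\pmod 4$ be a prime and $t=\prod_{x=1}^{(p-1)/2}x$. Let $\Gamma(t,p)$ be the number of $i\in\{1,\ldots,(p-1)/2\}$ with $\{ti\}_p>p/2$, and let $\gamma(t,p)$ be the number of pairs $(i,j)$ with $1\le i<j\le (p-1)/2$ and $\widetilde{ti}>\widetilde{tj}$. Then $\Gamma(t,p)=(p-1)/4$ and $\gamma(t,p)=\left((p-1)/4\right)^2$.
   Context: For an integer $x$, $\{x\}_p$ denotes the least nonnegative residue of $x$ modulo $p$, and $\widetilde{x}=p-\{x\}_p$ if $\{x\}_p>p/2$, while $\widetilde{x}=\{x\}_p$ if $\{x\}_p<p/2$. -}

module Defs where

open import Data.Nat using (ℕ; zero; suc; _+_; _*_; _∸_; _<_; _<?_; NonZero)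
open import Data.Nat.DivMod using (_%_)
open import Data.List using (List; []; _∷_; length; filter; map; concatMap)
open import Data.Product using (_×_; _,_)
open import Relation.Nullary using (Dec; yes; no)

range1 : ℕ → List ℕ
range1 zero = []
range1 (suc n) = range1 n Data.List.++ (suc n ∷ [])

res : (p : ℕ) → .{{NonZero p}} → ℕ → ℕ
res p x = x % p

-- {x}_p > p/2, written without division as p < 2 {x}_p
bigRes : (p : ℕ) → .{{NonZero p}} → ℕ → Set
bigRes p x = p < 2 * res p x

bigRes? : (p : ℕ) → .{{_ : NonZero p}} → (x : ℕ) → Dec (bigRes p x)
bigRes? p x = p <? 2 * res p x

tilde : (p : ℕ) → .{{NonZero p}} → ℕ → ℕ
tilde p x with bigRes? p x
... | yes _ = p ∸ res p x
... | no  _ = res p x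

Gamma : (t p : ℕ) → .{{NonZero p}} → ℕ
Gamma t p = length (filter (λ i → bigRes? p (t * i)) (range1 ((p ∸ 1) Data.Nat./ 2)))

pairsLt : ℕ → List (ℕ × ℕ)
pairsLt n = concatMap (λ j → concatMap (λ i → cond i j) (range1 n)) (range1 n)
  where
  cond : ℕ → ℕ → List (ℕ × ℕ)
  cond i j with i <? j
  ... | yes _ = (i , j) ∷ []
  ... | no  _ = []

gamma : (t p : ℕ) → .{{NonZero p}} → ℕ
gamma t p = length (filter (λ ij → tilde p (t * Data.Product.proj₂ ij) <? tilde p (t * Data.Product.proj₁ ij))
                            (pairsLt ((p ∸ 1) Data.Nat./ 2)))

-- Let n = (p − 1)/2 and t = n!. Pairing the factor n + i of (p − 1)! ≡ −1 (Wilson) with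
-- p − (n + i) = n + 1 − i gives t² ≡ −1 (mod p), since n is even; everything afterwards
-- uses only this and p = 2n + 1. Write r(k) = {tk}_p and σ(k) = \widetilde{tk}. Because
-- t·r(k) ≡ −k, σ is an involution of {1, …, n} exchanging the k with r(k) > p/2 and those
-- with r(k) < p/2, so Γ = n/2. Colour k by the parity of k + r(k); σ also exchanges the
-- two colours, so each colour class has n/2 elements. For i < j, σ(j) < σ(i) exactly when
-- j − i and the representative of ±(i + j) in {1, …, n} have different colours, and
-- (i, j) ↦ (j − i, ±(i + j)) permutes the pairs 1 ≤ i < j ≤ n; so γ counts the
-- bichromatic pairs, (n/2)².

module Submission where

open import Defs
open import Data.Empty using (⊥-elim)
open import Data.List using (List; []; _∷_; _++_; [_]; length; filter; map; concatMap; downFrom)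
open import Data.List.Properties using (length-++; filter-++; filter-accept; filter-reject)
open import Data.List.Membership.Propositional using (_∈_; find; lose)
open import Data.List.Membership.Propositional.Properties
  using (∈-map⁺; ∈-map⁻; ∈-++⁺ˡ; ∈-++⁺ʳ; ∈-++⁻; ∈-concatMap⁺; ∈-concatMap⁻; ∈-∃++; ∈-downFrom⁺; ∈-downFrom⁻)
open import Data.List.Membership.Propositional.Properties.WithK using (unique∧set⇒bag)
open import Data.List.Relation.Binary.BagAndSetEquality using (∼bag⇒↭)
open import Data.List.Relation.Binary.Permutation.Propositional using (_↭_; ↭-sym; ↭⇒↭ₛ)
open import Data.List.Relation.Binary.Permutation.Propositional.Properties using (filter-↭; ↭-length; shift; ∈-resp-↭)
import Data.List.Relation.Binary.Permutation.Setoid.Properties as Permutationₛ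
open import Data.List.Relation.Binary.Subset.Propositional using (_⊆_)
open import Data.List.Relation.Unary.All as All using ([]; _∷_)
open import Data.List.Relation.Unary.Any using (here; there)
open import Data.List.Relation.Unary.Unique.Propositional using (Unique; []; _∷_)
import Data.List.Relation.Unary.Unique.Propositional.Properties as Unique
open import Data.Nat
  using (ℕ; zero; suc; _+_; _*_; _∸_; _/_; _%_; _^_; _!; _<_; _≤_; _>_; _≤?_; _<?_; z≤n; s≤s;
         NonZero; >-nonZero; >-nonZero⁻¹; nonTrivial⇒n>1; parity)
open import Data.Nat.Coprimality using (prime⇒coprime; coprime-Bézout)
import Data.Nat.Coprimality as Coprime
open import Data.Nat.DivMod
  using (m%n<n; m*n/n≡m; m≡m%n+[m/n]*n; m%n%n≡m%n; [m+kn]%n≡m%n; m<n⇒m%n≡m; %-distribˡ-+; %-distribˡ-*)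
open import Data.Nat.Divisibility using (_∣_; ∣⇒≤; m%n≡0⇒n∣m; n∣m⇒m%n≡0)
open import Data.Nat.GCD using (module Bézout)
open import Data.Nat.ListAction using (product)
open import Data.Nat.ListAction.Properties using (product-↭)
open import Data.Nat.Primality using (Prime; euclidsLemma; prime⇒nonTrivial)
open import Data.Nat.Properties
open import Data.Nat.Solver using (module +-*-Solver)
open import Data.Parity.Base as ℙ using (Parity; 0ℙ; 1ℙ; _⁻¹)
import Data.Parity.Properties as ℙ
open import Data.Product using (Σ; ∃; _×_; _,_; proj₁; proj₂)
open import Data.Sum using (_⊎_; inj₁; inj₂)
open import Function using (_∘_; _⇔_; mk⇔; Equivalence)
open import Level using (0ℓ)
open import Relation.Binary.Bundles using (Setoid)
open import Relation.Binary.Definitions using (tri<; tri≈; tri>)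
open import Relation.Binary.PropositionalEquality
  using (_≡_; _≢_; refl; sym; trans; cong; cong₂; subst; subst₂; setoid; module ≡-Reasoning)
import Relation.Binary.Reasoning.Setoid as SetoidReasoning
open import Relation.Nullary using (¬_; Dec; yes; no; contradiction)
open import Relation.Unary using (Pred; Decidable)
open import Relation.Unary.Properties using (∁?)

-- Counting in lists

module _ {A : Set} where

  count : {P : Pred A 0ℓ} → Decidable P → List A → ℕ
  count P? xs = length (filter P? xs)

  module _ {P Q : Pred A 0ℓ} (P? : Decidable P) (Q? : Decidable Q) where

    count-cong : ∀ xs → (∀ {x} → x ∈ xs → P x ⇔ Q x) → count P? xs ≡ count Q? xs
    count-cong [] _ = refl
    count-cong (x ∷ xs) P⇔Q with P? x | Q? x
    ... | yes _  | yes _  = cong suc (count-cong xs (P⇔Q ∘ there))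
    ... | no _   | no _   = count-cong xs (P⇔Q ∘ there)
    ... | yes px | no ¬qx = contradiction (Equivalence.to (P⇔Q (here refl)) px) ¬qx
    ... | no ¬px | yes qx = contradiction (Equivalence.from (P⇔Q (here refl)) qx) ¬px

  module _ {P : Pred A 0ℓ} (P? : Decidable P) where

    count-++ : ∀ xs ys → count P? (xs ++ ys) ≡ count P? xs + count P? ys
    count-++ xs ys = trans (cong length (filter-++ P? xs ys)) (length-++ (filter P? xs))

    count-↭ : ∀ {xs ys} → xs ↭ ys → count P? xs ≡ count P? ys
    count-↭ = ↭-length ∘ filter-↭ P?

    count+count-∁ : ∀ xs → count P? xs + count (∁? P?) xs ≡ length xs
    count+count-∁ [] = refl
    count+count-∁ (x ∷ xs) with P? x
    ... | yes _ = cong suc (count+count-∁ xs)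
    ... | no _  = trans (+-suc _ _) (cong suc (count+count-∁ xs))

  unique∧⊆∧⊇⇒↭ : ∀ {xs ys : List A} → Unique xs → Unique ys → xs ⊆ ys → ys ⊆ xs → xs ↭ ys
  unique∧⊆∧⊇⇒↭ ux uy xs⊆ys ys⊆xs = ∼bag⇒↭ (unique∧set⇒bag ux uy (mk⇔ xs⊆ys ys⊆xs))

module _ {A B : Set} where

  count-map : ∀ {P : Pred B 0ℓ} (P? : Decidable P) (f : A → B) xs →
              count P? (map f xs) ≡ count (P? ∘ f) xs
  count-map P? f [] = refl
  count-map P? f (x ∷ xs) with P? (f x)
  ... | yes _ = cong suc (count-map P? f xs)
  ... | no _  = count-map P? f xs

  Unique-map⁺-on : ∀ (f : A → B) {xs} →
                   (∀ {x y} → x ∈ xs → y ∈ xs → f x ≡ f y → x ≡ y) →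
                   Unique xs → Unique (map f xs)
  Unique-map⁺-on f inj [] = []
  Unique-map⁺-on f inj (x∉xs ∷ u) =
    All.tabulate (λ fy∈ fx≡fy → let y , y∈ , fy≡ = ∈-map⁻ f fy∈ in
                   All.lookup x∉xs y∈ (inj (here refl) (there y∈) (trans fx≡fy fy≡)))
    ∷ Unique-map⁺-on f (λ x∈ y∈ → inj (there x∈) (there y∈)) u

  Unique-concatMap⁺ : ∀ (g : A → List B) {xs} → (∀ x → Unique (g x)) →
                      (∀ {x y z} → z ∈ g x → z ∈ g y → x ≡ y) →
                      Unique xs → Unique (concatMap g xs)
  Unique-concatMap⁺ g ug disjoint [] = []
  Unique-concatMap⁺ g ug disjoint (x∉xs ∷ u) =
    Unique.++⁺ (ug _) (Unique-concatMap⁺ g ug disjoint u) λ (z∈gx , z∈rest) →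
      let y , y∈ , z∈gy = find (∈-concatMap⁻ g z∈rest) in All.lookup x∉xs y∈ (disjoint z∈gx z∈gy)

Unique-resp-↭ : ∀ {A : Set} {xs ys : List A} → xs ↭ ys → Unique xs → Unique ys
Unique-resp-↭ {A} σ = Permutationₛ.Unique-resp-↭ (setoid A) (↭⇒↭ₛ σ)

∈⇒↭∷ : ∀ {A : Set} {x : A} {xs} → x ∈ xs → ∃ λ rest → xs ↭ x ∷ rest
∈⇒↭∷ x∈ with as , bs , refl ← ∈-∃++ x∈ = as ++ bs , shift _ as bs

module _ {A : Set} (f : A → A) {xs : List A} (unique : Unique xs) (f-into : ∀ {x} → x ∈ xs → f x ∈ xs) where

  map-↭-self : (∀ {x y} → x ∈ xs → y ∈ xs → f x ≡ f y → x ≡ y) →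
               (∀ {y} → y ∈ xs → ∃ λ x → x ∈ xs × f x ≡ y) →
               map f xs ↭ xs
  map-↭-self inj onto = unique∧⊆∧⊇⇒↭ (Unique-map⁺-on f inj unique) unique image⊆ ⊆image
    where
    image⊆ : map f xs ⊆ xs
    image⊆ y∈ = let x , x∈ , y≡fx = ∈-map⁻ f y∈ in subst (_∈ xs) (sym y≡fx) (f-into x∈)
    ⊆image : xs ⊆ map f xs
    ⊆image y∈ = let x , x∈ , fx≡y = onto y∈ in subst (_∈ map f xs) fx≡y (∈-map⁺ f x∈)

  module _ {P : Pred A 0ℓ} (P? : Decidable P) where

    count-∘-bijection : (∀ {x y} → x ∈ xs → y ∈ xs → f x ≡ f y → x ≡ y) →
                        (∀ {y} → y ∈ xs → ∃ λ x → x ∈ xs × f x ≡ y) →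
                        count P? xs ≡ count (P? ∘ f) xs
    count-∘-bijection inj onto =
      trans (count-↭ P? (↭-sym (map-↭-self inj onto))) (count-map P? f xs)

    count-involution-swapping : (∀ {x} → x ∈ xs → f (f x) ≡ x) →
                                (∀ {x} → x ∈ xs → P (f x) ⇔ (¬ P x)) →
                                count P? xs + count P? xs ≡ length xs
    count-involution-swapping involutive swaps = begin
      count P? xs + count P? xs           ≡⟨ cong (count P? xs +_) (count-∘-bijection inj onto) ⟩
      count P? xs + count (P? ∘ f) xs     ≡⟨ cong (count P? xs +_) (count-cong (P? ∘ f) (∁? P?) xs swaps) ⟩
      count P? xs + count (∁? P?) xs      ≡⟨ count+count-∁ P? xs ⟩
      length xs                           ∎
      where
      open ≡-Reasoning
      inj : ∀ {x y} → x ∈ xs → y ∈ xs → f x ≡ f y → x ≡ y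
      inj x∈ y∈ fx≡fy = trans (sym (involutive x∈)) (trans (cong f fx≡fy) (involutive y∈))
      onto : ∀ {y} → y ∈ xs → ∃ λ x → x ∈ xs × f x ≡ y
      onto y∈ = f _ , f-into y∈ , involutive y∈

∈-range1⁻ : ∀ n {x} → x ∈ range1 n → 0 < x × x ≤ n
∈-range1⁻ (suc n) x∈ with ∈-++⁻ (range1 n) x∈
... | inj₁ x∈′ = let 0<x , x≤n = ∈-range1⁻ n x∈′ in 0<x , m≤n⇒m≤1+n x≤n
... | inj₂ (here refl) = s≤s z≤n , ≤-refl

∈-range1⁺ : ∀ n {x} → 0 < x → x ≤ n → x ∈ range1 n
∈-range1⁺ zero {suc _} _ ()
∈-range1⁺ (suc n) 0<x x≤1+n with m≤n⇒m<n∨m≡n x≤1+n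
... | inj₁ (s≤s x≤n) = ∈-++⁺ˡ (∈-range1⁺ n 0<x x≤n)
... | inj₂ refl     = ∈-++⁺ʳ (range1 n) (here refl)

Unique-range1 : ∀ n → Unique (range1 n)
Unique-range1 zero    = []
Unique-range1 (suc n) = Unique.++⁺ (Unique-range1 n) ([] ∷ []) λ where
  (x∈ , here refl) → 1+n≰n (proj₂ (∈-range1⁻ n x∈))

length-range1 : ∀ n → length (range1 n) ≡ n
length-range1 zero    = refl
length-range1 (suc n) = trans (length-++ (range1 n)) (trans (cong (_+ 1) (length-range1 n)) (+-comm n 1))

PairLt : ℕ → ℕ × ℕ → Set
PairLt n (i , j) = 0 < i × i < j × j ≤ n

-- The filter used inside pairsLt is local to Defs; it is recovered by unification.
private
  pairsLt-unfolded : ∀ n → Σ (ℕ → ℕ → List (ℕ × ℕ)) λ cond →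
                     pairsLt n ≡ concatMap (λ j → concatMap (λ i → cond i j) (range1 n)) (range1 n)
  pairsLt-unfolded n = _ , refl

  cond : ℕ → ℕ → ℕ → List (ℕ × ℕ)
  cond n = proj₁ (pairsLt-unfolded n)

  cond-< : ∀ n {i j} → i < j → cond n i j ≡ [ (i , j) ]
  cond-< n {i} {j} i<j with i <? j
  ... | yes _   = refl
  ... | no i≮j = contradiction i<j i≮j

  ∈-cond⁻ : ∀ n i j {z} → z ∈ cond n i j → z ≡ (i , j) × i < j
  ∈-cond⁻ n i j z∈ with i <? j
  ∈-cond⁻ n i j (here z≡) | yes i<j = z≡ , i<j

  Unique-cond : ∀ n i j → Unique (cond n i j)
  Unique-cond n i j with i <? j
  ... | yes _ = [] ∷ []
  ... | no _  = []

  column : ℕ → ℕ → List (ℕ × ℕ)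
  column n j = concatMap (λ i → cond n i j) (range1 n)

∈-pairsLt⁻ : ∀ n {z} → z ∈ pairsLt n → PairLt n z
∈-pairsLt⁻ n z∈ with find (∈-concatMap⁻ (column n) {xs = range1 n} z∈)
... | j , j∈ , z∈col with find (∈-concatMap⁻ (λ i → cond n i j) {xs = range1 n} z∈col)
... | i , i∈ , z∈cond with ∈-cond⁻ n i j z∈cond
... | refl , i<j = proj₁ (∈-range1⁻ n i∈) , i<j , proj₂ (∈-range1⁻ n j∈)

∈-pairsLt⁺ : ∀ n {i j} → PairLt n (i , j) → (i , j) ∈ pairsLt n
∈-pairsLt⁺ n {i} {j} (0<i , i<j , j≤n) =
  ∈-concatMap⁺ (column n) (lose (∈-range1⁺ n (<-trans 0<i i<j) j≤n)
    (∈-concatMap⁺ (λ i → cond n i j) (lose (∈-range1⁺ n 0<i (<⇒≤ (<-≤-trans i<j j≤n)))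
      (subst ((i , j) ∈_) (sym (cond-< n i<j)) (here refl)))))

private
  ∈-column⁻ : ∀ n j {z} → z ∈ column n j → proj₂ z ≡ j
  ∈-column⁻ n j z∈ with find (∈-concatMap⁻ (λ i → cond n i j) {xs = range1 n} z∈)
  ... | i , _ , z∈cond = cong proj₂ (proj₁ (∈-cond⁻ n i j z∈cond))

Unique-pairsLt : ∀ n → Unique (pairsLt n)
Unique-pairsLt n = Unique-concatMap⁺ (column n) Unique-column
  (λ {j} {j′} z∈ z∈′ → trans (sym (∈-column⁻ n j z∈)) (∈-column⁻ n j′ z∈′)) (Unique-range1 n)
  where
  Unique-column : ∀ j → Unique (column n j)
  Unique-column j = Unique-concatMap⁺ (λ i → cond n i j) (λ i → Unique-cond n i j)
    (λ {i} {i′} z∈ z∈′ → cong proj₁ (trans (sym (proj₁ (∈-cond⁻ n i j z∈))) (proj₁ (∈-cond⁻ n i′ j z∈′))))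
    (Unique-range1 n)

pairsLt-suc : ∀ n → pairsLt (suc n) ↭ pairsLt n ++ map (_, suc n) (range1 n)
pairsLt-suc n = unique∧⊆∧⊇⇒↭ (Unique-pairsLt (suc n))
  (Unique.++⁺ (Unique-pairsLt n) (Unique.map⁺ (cong proj₁) (Unique-range1 n)) disjoint) ⊆split split⊆
  where
  disjoint : ∀ {z} → ¬ (z ∈ pairsLt n × z ∈ map (_, suc n) (range1 n))
  disjoint (z∈ , z∈′) with ∈-map⁻ (_, suc n) z∈′
  ... | _ , _ , refl = 1+n≰n (proj₂ (proj₂ (∈-pairsLt⁻ n z∈)))
  ⊆split : ∀ {z} → z ∈ pairsLt (suc n) → z ∈ pairsLt n ++ map (_, suc n) (range1 n)
  ⊆split {i , j} z∈ with ∈-pairsLt⁻ (suc n) z∈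
  ... | 0<i , i<j , j≤1+n with m≤n⇒m<n∨m≡n j≤1+n
  ... | inj₁ (s≤s j≤n) = ∈-++⁺ˡ (∈-pairsLt⁺ n (0<i , i<j , j≤n))
  ... | inj₂ refl     = ∈-++⁺ʳ (pairsLt n) (∈-map⁺ (_, suc n) (∈-range1⁺ n 0<i (≤-pred i<j)))
  split⊆ : ∀ {z} → z ∈ pairsLt n ++ map (_, suc n) (range1 n) → z ∈ pairsLt (suc n)
  split⊆ z∈ with ∈-++⁻ (pairsLt n) z∈
  ... | inj₁ z∈′ = let 0<i , i<j , j≤n = ∈-pairsLt⁻ n z∈′ in ∈-pairsLt⁺ (suc n) (0<i , i<j , m≤n⇒m≤1+n j≤n)
  ... | inj₂ z∈′ with ∈-map⁻ (_, suc n) z∈′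
  ... | i , i∈ , refl = let 0<i , i≤n = ∈-range1⁻ n i∈ in ∈-pairsLt⁺ (suc n) (0<i , s≤s i≤n , ≤-refl)

-- Parities and two-colourings

double-injective : ∀ {a b} → a + a ≡ b + b → a ≡ b
double-injective {a} {b} a+a≡b+b with <-cmp a b
... | tri< a<b _ _ = contradiction a+a≡b+b (<⇒≢ (+-mono-< a<b a<b))
... | tri≈ _ a≡b _ = a≡b
... | tri> _ _ b<a = contradiction (sym a+a≡b+b) (<⇒≢ (+-mono-< b<a b<a))

even-or-odd : ∀ m → ∃ λ k → m ≡ k + k ⊎ m ≡ suc (k + k)
even-or-odd zero = 0 , inj₁ refl
even-or-odd (suc m) with even-or-odd m
... | k , inj₁ m≡2k   = k , inj₂ (cong suc m≡2k)
... | k , inj₂ m≡2k+1 = suc k , inj₁ (trans (cong suc m≡2k+1) (cong suc (sym (+-suc k k))))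

+≡1ℙ⇔≡⁻¹ : ∀ a b → a ℙ.+ b ≡ 1ℙ ⇔ a ≡ b ⁻¹
+≡1ℙ⇔≡⁻¹ 0ℙ 0ℙ = mk⇔ (λ ()) (λ ())
+≡1ℙ⇔≡⁻¹ 0ℙ 1ℙ = mk⇔ (λ _ → refl) (λ _ → refl)
+≡1ℙ⇔≡⁻¹ 1ℙ 0ℙ = mk⇔ (λ _ → refl) (λ _ → refl)
+≡1ℙ⇔≡⁻¹ 1ℙ 1ℙ = mk⇔ (λ ()) (λ ())

+≡0ℙ⇒≡ : ∀ a b → a ℙ.+ b ≡ 0ℙ → a ≡ b
+≡0ℙ⇒≡ 0ℙ 0ℙ _ = refl
+≡0ℙ⇒≡ 1ℙ 1ℙ _ = refl

⁻¹≡1ℙ⇔≢1ℙ : ∀ a → a ⁻¹ ≡ 1ℙ ⇔ (¬ a ≡ 1ℙ)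
⁻¹≡1ℙ⇔≢1ℙ 0ℙ = mk⇔ (λ _ ()) (λ _ → refl)
⁻¹≡1ℙ⇔≢1ℙ 1ℙ = mk⇔ (λ ()) (λ ≢ → contradiction refl ≢)

≡0ℙ⇔≢1ℙ : ∀ a → a ≡ 0ℙ ⇔ (¬ a ≡ 1ℙ)
≡0ℙ⇔≢1ℙ 0ℙ = mk⇔ (λ _ ()) (λ _ → refl)
≡0ℙ⇔≢1ℙ 1ℙ = mk⇔ (λ ()) (λ ≢ → contradiction refl ≢)

module _ (colour : ℕ → Parity) where

  bichromatic? : (z : ℕ × ℕ) → Dec (colour (proj₁ z) ℙ.+ colour (proj₂ z) ≡ 1ℙ)
  bichromatic? (i , j) = colour i ℙ.+ colour j ℙ.≟ 1ℙ

  coloured : Parity → ℕ → ℕ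
  coloured b n = count (λ i → colour i ℙ.≟ b) (range1 n)

  coloured-suc-≡ : ∀ {b} n → colour (suc n) ≡ b → coloured b (suc n) ≡ suc (coloured b n)
  coloured-suc-≡ {b} n c≡b = trans (count-++ (λ i → colour i ℙ.≟ b) (range1 n) [ suc n ])
    (trans (cong (λ k → coloured b n + length k) (filter-accept (λ i → colour i ℙ.≟ b) c≡b)) (+-comm _ 1))

  coloured-suc-≢ : ∀ {b} n → colour (suc n) ≢ b → coloured b (suc n) ≡ coloured b n
  coloured-suc-≢ {b} n c≢b = trans (count-++ (λ i → colour i ℙ.≟ b) (range1 n) [ suc n ])
    (trans (cong (λ k → coloured b n + length k) (filter-reject (λ i → colour i ℙ.≟ b) c≢b)) (+-comm _ 0))

  count-bichromatic-pairsLt : ∀ n → count bichromatic? (pairsLt n) ≡ coloured 0ℙ n * coloured 1ℙ n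
  count-bichromatic-pairsLt zero    = refl
  count-bichromatic-pairsLt (suc n) = begin
    count bichromatic? (pairsLt (suc n))
      ≡⟨ count-↭ bichromatic? (pairsLt-suc n) ⟩
    count bichromatic? (pairsLt n ++ map (_, suc n) (range1 n))
      ≡⟨ count-++ bichromatic? (pairsLt n) _ ⟩
    count bichromatic? (pairsLt n) + count bichromatic? (map (_, suc n) (range1 n))
      ≡⟨ cong₂ _+_ (count-bichromatic-pairsLt n) new-column ⟩
    coloured 0ℙ n * coloured 1ℙ n + coloured (colour (suc n) ⁻¹) n
      ≡⟨ add-column ⟩
    coloured 0ℙ (suc n) * coloured 1ℙ (suc n) ∎
    where
    open ≡-Reasoning
    new-column : count bichromatic? (map (_, suc n) (range1 n)) ≡ coloured (colour (suc n) ⁻¹) n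
    new-column = trans (count-map bichromatic? (_, suc n) (range1 n))
      (count-cong (bichromatic? ∘ (_, suc n)) (λ i → colour i ℙ.≟ colour (suc n) ⁻¹) (range1 n)
        (λ {i} _ → +≡1ℙ⇔≡⁻¹ (colour i) (colour (suc n))))
    add-column : coloured 0ℙ n * coloured 1ℙ n + coloured (colour (suc n) ⁻¹) n
               ≡ coloured 0ℙ (suc n) * coloured 1ℙ (suc n)
    add-column with colour (suc n) in c≡
    ... | 0ℙ = trans (+-comm _ (coloured 1ℙ n))
                 (sym (cong₂ _*_ (coloured-suc-≡ n c≡) (coloured-suc-≢ n (λ c≡1 → ℙ.p≢p⁻¹ 0ℙ (trans (sym c≡) c≡1)))))
    ... | 1ℙ = trans (trans (+-comm _ (coloured 0ℙ n)) (sym (*-suc (coloured 0ℙ n) (coloured 1ℙ n))))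
                 (sym (cong₂ _*_ (coloured-suc-≢ n (λ c≡0 → ℙ.p≢p⁻¹ 1ℙ (trans (sym c≡) c≡0))) (coloured-suc-≡ n c≡)))

-- Congruences modulo p

module Modular (p : ℕ) .{{_ : NonZero p}} where

  infix 4 _≈_

  -- A record rather than an abbreviation of a % p ≡ b % p, so that a and b are inferable.
  record _≈_ (a b : ℕ) : Set where
    constructor mod
    field unmod : a % p ≡ b % p

  open _≈_ public

  ≈-refl : ∀ {a} → a ≈ a
  ≈-refl = mod refl

  ≈-sym : ∀ {a b} → a ≈ b → b ≈ a
  ≈-sym (mod e) = mod (sym e)

  ≈-trans : ∀ {a b c} → a ≈ b → b ≈ c → a ≈ c
  ≈-trans (mod e) (mod e′) = mod (trans e e′)

  ≡⇒≈ : ∀ {a b} → a ≡ b → a ≈ b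
  ≡⇒≈ refl = ≈-refl

  ≈-setoid : Setoid _ _
  ≈-setoid = record
    { Carrier = ℕ ; _≈_ = _≈_
    ; isEquivalence = record { refl = ≈-refl ; sym = ≈-sym ; trans = ≈-trans } }

  module ≈-Reasoning = SetoidReasoning ≈-setoid

  +-cong : ∀ {a b c d} → a ≈ b → c ≈ d → a + c ≈ b + d
  +-cong {a} {b} {c} {d} (mod e) (mod e′) = mod (begin
    (a + c) % p           ≡⟨ %-distribˡ-+ a c p ⟩
    (a % p + c % p) % p   ≡⟨ cong₂ (λ x y → (x + y) % p) e e′ ⟩
    (b % p + d % p) % p   ≡⟨ %-distribˡ-+ b d p ⟨
    (b + d) % p           ∎)
    where open ≡-Reasoning

  *-cong : ∀ {a b c d} → a ≈ b → c ≈ d → a * c ≈ b * d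
  *-cong {a} {b} {c} {d} (mod e) (mod e′) = mod (begin
    (a * c) % p           ≡⟨ %-distribˡ-* a c p ⟩
    (a % p * (c % p)) % p ≡⟨ cong₂ (λ x y → (x * y) % p) e e′ ⟩
    (b % p * (d % p)) % p ≡⟨ %-distribˡ-* b d p ⟨
    (b * d) % p           ∎)
    where open ≡-Reasoning

  +-congˡ : ∀ {a b} c → a ≈ b → c + a ≈ c + b
  +-congˡ c = +-cong (≈-refl {c})

  +-congʳ : ∀ {a b} c → a ≈ b → a + c ≈ b + c
  +-congʳ c e = +-cong e (≈-refl {c})

  *-congˡ : ∀ {a b} c → a ≈ b → c * a ≈ c * b
  *-congˡ c = *-cong (≈-refl {c})

  *-congʳ : ∀ {a b} c → a ≈ b → a * c ≈ b * c
  *-congʳ c e = *-cong e (≈-refl {c})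

  m%p≈m : ∀ a → a % p ≈ a
  m%p≈m a = mod (m%n%n≡m%n a p)

  m+kp≈m : ∀ a k → a + k * p ≈ a
  m+kp≈m a k = mod ([m+kn]%n≡m%n a k p)

  m+p≈m : ∀ a → a + p ≈ a
  m+p≈m a = ≈-trans (≡⇒≈ (cong (a +_) (sym (*-identityˡ p)))) (m+kp≈m a 1)

  kp≈0 : ∀ k → k * p ≈ 0
  kp≈0 k = m+kp≈m 0 k

  ≈⇒≡ : ∀ {a b} → a < p → b < p → a ≈ b → a ≡ b
  ≈⇒≡ a<p b<p (mod e) = trans (sym (m<n⇒m%n≡m a<p)) (trans e (m<n⇒m%n≡m b<p))

  +-cancelʳ-≈ : ∀ a b c → a + c ≈ b + c → a ≈ b
  +-cancelʳ-≈ a b c a+c≈b+c = begin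
    a                 ≈⟨ cancel a ⟨
    a + c + (p ∸ c′)  ≈⟨ +-congʳ (p ∸ c′) a+c≈b+c ⟩
    b + c + (p ∸ c′)  ≈⟨ cancel b ⟩
    b                 ∎
    where
    open ≈-Reasoning
    c′ = c % p
    cancel : ∀ x → x + c + (p ∸ c′) ≈ x
    cancel x = begin
      x + c + (p ∸ c′)   ≈⟨ +-congʳ (p ∸ c′) (+-congˡ x (m%p≈m c)) ⟨
      x + c′ + (p ∸ c′)  ≡⟨ +-assoc x c′ (p ∸ c′) ⟩
      x + (c′ + (p ∸ c′)) ≡⟨ cong (x +_) (m+[n∸m]≡n (<⇒≤ (m%n<n c p))) ⟩
      x + p              ≈⟨ m+p≈m x ⟩
      x                  ∎

  0%p≡0 : 0 % p ≡ 0
  0%p≡0 = m<n⇒m%n≡m (>-nonZero⁻¹ p)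

  ≈0⇒∣ : ∀ {a} → a ≈ 0 → p ∣ a
  ≈0⇒∣ {a} (mod e) = m%n≡0⇒n∣m a p (trans e 0%p≡0)

  ∣⇒≈0 : ∀ {a} → p ∣ a → a ≈ 0
  ∣⇒≈0 {a} p∣a = mod (trans (n∣m⇒m%n≡0 a p p∣a) (sym 0%p≡0))

  positive-≉0 : ∀ {a} → 0 < a → a < p → ¬ a ≈ 0
  positive-≉0 {suc _} _ a<p a≈0 = <⇒≱ a<p (∣⇒≤ (≈0⇒∣ a≈0))

  +≈0⇒%≡∸ : ∀ {a b} → 0 < b → b < p → a + b ≈ 0 → a % p ≡ p ∸ b
  +≈0⇒%≡∸ {a} {b} 0<b b<p a+b≈0 = ≈⇒≡ (m%n<n a p) (∸-monoʳ-< 0<b (<⇒≤ b<p)) (begin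
    a % p        ≈⟨ m%p≈m a ⟩
    a            ≈⟨ +-cancelʳ-≈ a (p ∸ b) b (begin
                      a + b        ≈⟨ a+b≈0 ⟩
                      0            ≈⟨ m+p≈m 0 ⟨
                      p            ≡⟨ m∸n+n≡m (<⇒≤ b<p) ⟨
                      p ∸ b + b    ∎) ⟩
    p ∸ b        ∎)
    where open ≈-Reasoning

  +≈0⇒[p∸1]*≈ : ∀ {a b} → a + b ≈ 0 → (p ∸ 1) * a ≈ b
  +≈0⇒[p∸1]*≈ {a} {b} a+b≈0 = +-cancelʳ-≈ ((p ∸ 1) * a) b a (begin
    (p ∸ 1) * a + a  ≡⟨ cong ((p ∸ 1) * a +_) (sym (*-identityˡ a)) ⟩
    (p ∸ 1) * a + 1 * a ≡⟨ *-distribʳ-+ a (p ∸ 1) 1 ⟨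
    (p ∸ 1 + 1) * a  ≡⟨ cong (_* a) (m∸n+n≡m (>-nonZero⁻¹ p)) ⟩
    p * a            ≡⟨ *-comm p a ⟩
    a * p            ≈⟨ kp≈0 a ⟩
    0                ≈⟨ a+b≈0 ⟨
    a + b            ≡⟨ +-comm a b ⟩
    b + a            ∎)
    where open ≈-Reasoning

  +≈⇒≡ : ∀ {a b c} → a < p → c ≤ b → b ∸ c < p → a + c ≈ b → a + c ≡ b
  +≈⇒≡ {a} {b} {c} a<p c≤b b∸c<p a+c≈b = trans (cong (_+ c) a≡b∸c) (m∸n+n≡m c≤b)
    where
    a≡b∸c : a ≡ b ∸ c
    a≡b∸c = ≈⇒≡ a<p b∸c<p (+-cancelʳ-≈ a (b ∸ c) c (≈-trans a+c≈b (≡⇒≈ (sym (m∸n+n≡m c≤b)))))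

  difference-≡ : ∀ {d x y} → d < p → x < y → y < p → d + x ≈ y → d + x ≡ y
  difference-≡ {d} {x} {y} d<p x<y y<p = +≈⇒≡ d<p (<⇒≤ x<y) (≤-<-trans (m∸n≤m y x) y<p)

  difference-wrap-≡ : ∀ {d x y} → d < p → y < x → x < p → d + x ≈ y → d + x ≡ y + p
  difference-wrap-≡ {d} {x} {y} d<p y<x x<p d+x≈y =
    +≈⇒≡ d<p (≤-trans (<⇒≤ x<p) (m≤n+m p y))
         (subst (y + p ∸ x <_) (m+n∸m≡n x p) (∸-monoˡ-< (+-monoˡ-< p y<x) (≤-trans (<⇒≤ x<p) (m≤n+m p y))))
         (≈-trans d+x≈y (≈-sym (m+p≈m y)))

  sum-wrap-≡ : ∀ {s x y} → s < p → x < p → y < p → p < x + y → s ≈ x + y → s + p ≡ x + y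
  sum-wrap-≡ {s} {x} {y} s<p x<p y<p p<x+y s≈x+y =
    +≈⇒≡ s<p (<⇒≤ p<x+y) (subst (x + y ∸ p <_) (m+n∸m≡n p p) (∸-monoˡ-< (+-mono-< x<p y<p) (<⇒≤ p<x+y)))
         (≈-trans (m+p≈m s) s≈x+y)

-- Inverses modulo a prime and Wilson's theorem

module Field (p : ℕ) .{{_ : NonZero p}} (p-prime : Prime p) where

  open Modular p
  open ≈-Reasoning

  1<p : 1 < p
  1<p = nonTrivial⇒n>1 p {{prime⇒nonTrivial p-prime}}

  0≉1 : ¬ 0 ≈ 1
  0≉1 0≈1 = positive-≉0 (s≤s z≤n) 1<p (≈-sym 0≈1)

  *-≉0 : ∀ {a b} → ¬ a ≈ 0 → ¬ b ≈ 0 → ¬ a * b ≈ 0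
  *-≉0 {a} {b} a≉0 b≉0 ab≈0 with euclidsLemma a b p-prime (≈0⇒∣ ab≈0)
  ... | inj₁ p∣a = a≉0 (∣⇒≈0 p∣a)
  ... | inj₂ p∣b = b≉0 (∣⇒≈0 p∣b)

  private
    has-inverse : ∀ {x} → 0 < x → x < p → ∃ λ a → x * a ≈ 1
    has-inverse {x} 0<x x<p with coprime-Bézout (Coprime.sym (prime⇒coprime p-prime {{>-nonZero 0<x}} x<p))
    ... | Bézout.+- a b 1+bp≡ax = a , (begin
      x * a       ≡⟨ *-comm x a ⟩
      a * x       ≡⟨ 1+bp≡ax ⟨
      1 + b * p   ≈⟨ m+kp≈m 1 b ⟩
      1           ∎)
    ... | Bézout.-+ a b 1+ax≡bp = (p ∸ 1) * a , (begin
      x * ((p ∸ 1) * a) ≡⟨ solve 3 (λ x q a → x :* (q :* a) := q :* (a :* x)) refl x (p ∸ 1) a ⟩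
      (p ∸ 1) * (a * x) ≈⟨ +≈0⇒[p∸1]*≈ (≈-trans (≡⇒≈ (trans (+-comm (a * x) 1) 1+ax≡bp)) (kp≈0 b)) ⟩
      1                 ∎)
      where open +-*-Solver

  inverse : ∀ {x} → 0 < x → x < p → ∃ λ y → 0 < y × y < p × x * y ≈ 1
  inverse {x} 0<x x<p with has-inverse 0<x x<p
  ... | a , xa≈1 = a % p , n≢0⇒n>0 a%p≢0 , m%n<n a p , xa%p≈1
    where
    xa%p≈1 : x * (a % p) ≈ 1
    xa%p≈1 = ≈-trans (*-congˡ x (m%p≈m a)) xa≈1
    a%p≢0 : a % p ≢ 0
    a%p≢0 a%p≡0 = 0≉1 (≈-trans (≡⇒≈ (sym (*-zeroʳ x))) (≈-trans (≡⇒≈ (cong (x *_) (sym a%p≡0))) xa%p≈1))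

  inverse-unique : ∀ {x a b} → a * x ≈ 1 → b * x ≈ 1 → a ≈ b
  inverse-unique {x} {a} {b} ax≈1 bx≈1 = begin
    a           ≡⟨ *-identityʳ a ⟨
    a * 1       ≈⟨ *-congˡ a bx≈1 ⟨
    a * (b * x) ≡⟨ solve 3 (λ a b x → a :* (b :* x) := b :* (a :* x)) refl a b x ⟩
    b * (a * x) ≈⟨ *-congˡ b ax≈1 ⟩
    b * 1       ≡⟨ *-identityʳ b ⟩
    b           ∎
    where open +-*-Solver

  square≉1 : ∀ {x} → 1 < x → suc x < p → ¬ x * x ≈ 1
  square≉1 {suc zero} (s≤s ())
  square≉1 {suc (suc k)} _ 3+k<p square≈1 =
    *-≉0 (positive-≉0 (s≤s z≤n) (<-trans (n<1+n (suc k)) (<-trans (n<1+n _) 3+k<p)))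
         (positive-≉0 (s≤s z≤n) 3+k<p)
         (+-cancelʳ-≈ _ 0 1 (≈-trans (≡⇒≈ factor) square≈1))
    where
    open +-*-Solver
    factor : suc k * (3 + k) + 1 ≡ (2 + k) * (2 + k)
    factor = solve 1 (λ k → (con 1 :+ k) :* (con 3 :+ k) :+ con 1 := (con 2 :+ k) :* (con 2 :+ k)) refl k

  InverseClosed : List ℕ → Set
  InverseClosed xs = ∀ {x} → x ∈ xs → ∃ λ y → y ∈ xs × x * y ≈ 1

  NotSelfInverse : ℕ → Set
  NotSelfInverse x = 1 < x × suc x < p

  product-inverseClosed : ∀ {xs} → Unique xs → (∀ {x} → x ∈ xs → NotSelfInverse x) →
                          InverseClosed xs → product xs ≈ 1
  product-inverseClosed {xs} = go (length xs) ≤-refl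
    where
    go : ∀ fuel {xs} → length xs ≤ fuel → Unique xs → (∀ {x} → x ∈ xs → NotSelfInverse x) →
         InverseClosed xs → product xs ≈ 1
    go _ {[]} _ _ _ _ = ≈-refl
    go (suc fuel) {x ∷ ys} (s≤s len) (x∉ys ∷ unique) bounded closed with closed (here refl)
    ... | x , here refl , x²≈1 = contradiction x²≈1 (square≉1 (proj₁ (bounded (here refl))) (proj₂ (bounded (here refl))))
    ... | y , there y∈ys , xy≈1 with rest , ys↭y∷rest ← ∈⇒↭∷ y∈ys = begin
      x * product ys          ≡⟨ cong (x *_) (product-↭ ys↭y∷rest) ⟩
      x * (y * product rest)  ≡⟨ *-assoc x y _ ⟨
      x * y * product rest    ≈⟨ *-congʳ (product rest) xy≈1 ⟩
      1 * product rest        ≡⟨ *-identityˡ _ ⟩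
      product rest            ≈⟨ go fuel len-rest unique-rest (bounded ∘ there ∘ ⊆ys) closed-rest ⟩
      1                       ∎
      where
      ⊆ys : ∀ {z} → z ∈ rest → z ∈ ys
      ⊆ys z∈ = ∈-resp-↭ (↭-sym ys↭y∷rest) (there z∈)
      y∉rest-unique-rest : (∀ {z} → z ∈ rest → y ≢ z) × Unique rest
      y∉rest-unique-rest with Unique-resp-↭ ys↭y∷rest unique
      ... | y∉ ∷ u = (λ z∈ → All.lookup y∉ z∈) , u
      unique-rest = proj₂ y∉rest-unique-rest
      len-rest : length rest ≤ fuel
      len-rest = ≤-trans (n≤1+n _) (subst (_≤ fuel) (↭-length ys↭y∷rest) len)
      below-p : ∀ {z} → z ∈ x ∷ ys → z < p
      below-p z∈ = <-trans (n<1+n _) (proj₂ (bounded z∈))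
      closed-rest : InverseClosed rest
      closed-rest {z} z∈ with closed (there (⊆ys z∈))
      ... | w , here refl , zx≈1 = ⊥-elim (proj₁ y∉rest-unique-rest z∈
              (≈⇒≡ (below-p (there y∈ys)) (below-p (there (⊆ys z∈)))
                 (inverse-unique (≈-trans (≡⇒≈ (*-comm y x)) xy≈1) zx≈1)))
      ... | w , there w∈ys , zw≈1 with ∈-resp-↭ ys↭y∷rest w∈ys
      ... | here refl = ⊥-elim (All.lookup x∉ys (⊆ys z∈)
              (≈⇒≡ (below-p (here refl)) (below-p (there (⊆ys z∈))) (inverse-unique xy≈1 zw≈1)))
      ... | there w∈rest = w , w∈rest , zw≈1

  inverse-notSelfInverse : ∀ {x y} → NotSelfInverse x → 0 < y → y < p → x * y ≈ 1 → NotSelfInverse y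
  inverse-notSelfInverse {x} {suc zero} (1<x , 1+x<p) _ _ x*1≈1 =
    ⊥-elim (>⇒≢ 1<x (≈⇒≡ (<-trans (n<1+n x) 1+x<p) 1<p (≈-trans (≡⇒≈ (sym (*-identityʳ x))) x*1≈1)))
  inverse-notSelfInverse {x} {suc (suc j)} (_ , 1+x<p) _ y<p xy≈1 with m≤n⇒m<n∨m≡n y<p
  ... | inj₁ 1+y<p = s≤s (s≤s z≤n) , 1+y<p
  ... | inj₂ 1+y≡p = ⊥-elim (positive-≉0 (s≤s z≤n) 1+x<p (begin
    1 + x             ≈⟨ +-congʳ x xy≈1 ⟨
    x * y + x         ≡⟨ +-comm (x * y) x ⟩
    x + x * y         ≡⟨ *-suc x y ⟨
    x * suc y         ≡⟨ cong (x *_) 1+y≡p ⟩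
    x * p             ≈⟨ kp≈0 x ⟩
    0                 ∎))
    where y = suc (suc j)

  private
    suc-!≡product : ∀ k → suc k ! ≡ product (map (2 +_) (downFrom k))
    suc-!≡product zero    = refl
    suc-!≡product (suc k) = cong ((2 + k) *_) (suc-!≡product k)

    module Middle (k : ℕ) (p≡3+k : p ≡ 3 + k) where

      middle : List ℕ
      middle = map (2 +_) (downFrom k)

      ∈-middle⁻ : ∀ {x} → x ∈ middle → NotSelfInverse x
      ∈-middle⁻ x∈ with ∈-map⁻ (2 +_) x∈
      ... | i , i∈ , refl = s≤s (s≤s z≤n) , subst (3 + i <_) (sym p≡3+k) (+-monoʳ-< 3 (∈-downFrom⁻ i∈))

      ∈-middle⁺ : ∀ {x} → NotSelfInverse x → x ∈ middle
      ∈-middle⁺ {suc zero} (s≤s () , _)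
      ∈-middle⁺ {suc (suc i)} (_ , 3+i<p) =
        ∈-map⁺ (2 +_) (∈-downFrom⁺ (+-cancelˡ-< 3 i k (subst (3 + i <_) p≡3+k 3+i<p)))

      middle-inverseClosed : InverseClosed middle
      middle-inverseClosed x∈ with inverse (<-trans (s≤s z≤n) (proj₁ (∈-middle⁻ x∈))) (<-trans (n<1+n _) (proj₂ (∈-middle⁻ x∈)))
      ... | y , 0<y , y<p , xy≈1 = y , ∈-middle⁺ (inverse-notSelfInverse (∈-middle⁻ x∈) 0<y y<p xy≈1) , xy≈1

      wilson-suc : (2 + k) ! ≈ 2 + k
      wilson-suc = begin
        (2 + k) * suc k !  ≡⟨ cong ((2 + k) *_) (suc-!≡product k) ⟩
        (2 + k) * product middle ≈⟨ *-congˡ (2 + k) (product-inverseClosed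
                                       (Unique.map⁺ (+-cancelˡ-≡ 2 _ _) (Unique.downFrom⁺ k)) ∈-middle⁻ middle-inverseClosed) ⟩
        (2 + k) * 1        ≡⟨ *-identityʳ (2 + k) ⟩
        2 + k              ∎

  wilson : (p ∸ 1) ! ≈ p ∸ 1
  wilson = subst (λ m → m ! ≈ m) (sym (cong (_∸ 1) p≡2+k)) (wilson-from (p ∸ 2) p≡2+k)
    where
    p≡2+k : p ≡ 2 + (p ∸ 2)
    p≡2+k = sym (m+[n∸m]≡n 1<p)
    wilson-from : ∀ k → p ≡ 2 + k → suc k ! ≈ suc k
    wilson-from zero    _     = ≈-refl
    wilson-from (suc k) p≡3+k = Middle.wilson-suc k p≡3+k

-- ((p − 1)/2)! squares to −1 when p ≡ 1 (mod 4)

rising : ℕ → ℕ → ℕ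
rising a zero    = 1
rising a (suc k) = (a + suc k) * rising a k

+-!≡rising*! : ∀ a k → (a + k) ! ≡ rising a k * a !
+-!≡rising*! a zero    = trans (cong _! (+-identityʳ a)) (sym (+-identityʳ (a !)))
+-!≡rising*! a (suc k) = begin
  (a + suc k) !                ≡⟨ cong _! (+-suc a k) ⟩
  suc (a + k) * (a + k) !      ≡⟨ cong₂ _*_ (sym (+-suc a k)) (+-!≡rising*! a k) ⟩
  (a + suc k) * (rising a k * a !) ≡⟨ *-assoc (a + suc k) _ _ ⟨
  rising a (suc k) * a !       ∎
  where open ≡-Reasoning

module _ (p : ℕ) .{{_ : NonZero p}} where

  open Modular p
  open +-*-Solver

  complement-*-≈ : ∀ {x x′ y y′} → x + x′ ≡ p → y + y′ ≡ p → x * y ≈ x′ * y′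
  complement-*-≈ {x} {x′} {y} {y′} x+x′≡p y+y′≡p = begin
    x * y                           ≈⟨ m+kp≈m (x * y) (x′ + y′) ⟨
    x * y + (x′ + y′) * p           ≡⟨ cong (x * y +_) (*-distribʳ-+ p x′ y′) ⟩
    x * y + (x′ * p + y′ * p)       ≡⟨ cong₂ (λ a b → x * y + (x′ * a + y′ * b)) (sym y+y′≡p) (sym x+x′≡p) ⟩
    x * y + (x′ * (y + y′) + y′ * (x + x′))
      ≡⟨ solve 4 (λ x x′ y y′ → x :* y :+ (x′ :* (y :+ y′) :+ y′ :* (x :+ x′))
                                := x′ :* y′ :+ (x :+ x′) :* (y :+ y′)) refl x x′ y y′ ⟩
    x′ * y′ + (x + x′) * (y + y′)   ≡⟨ cong (x′ * y′ +_) (cong₂ _*_ x+x′≡p y+y′≡p) ⟩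
    x′ * y′ + p * p                 ≈⟨ m+kp≈m (x′ * y′) p ⟩
    x′ * y′                         ∎
    where open ≈-Reasoning

  module _ {n : ℕ} (p≡2n+1 : p ≡ suc (n + n)) where

    rising-even≈ : ∀ j r → n ≡ j + j + r → rising n (j + j) * r ! ≈ n !
    rising-even≈ zero    r n≡r = ≡⇒≈ (trans (+-identityʳ (r !)) (cong _! (sym n≡r)))
    rising-even≈ (suc j) r n≡ = begin
      rising n (suc j + suc j) * r !                      ≡⟨ cong (λ k → rising n k * r !) (cong suc (+-suc j j)) ⟩
      (n + (2 + k)) * ((n + (1 + k)) * rising n k) * r !
        ≡⟨ solve 4 (λ a b f r → a :* (b :* f) :* r := (a :* b) :* (f :* r)) refl (n + (2 + k)) (n + (1 + k)) (rising n k) (r !) ⟩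
      (n + (2 + k)) * (n + (1 + k)) * (rising n k * r !)
        ≈⟨ *-congʳ (rising n k * r !) (complement-*-≈ sum₁ sum₂) ⟩
      (1 + r) * (2 + r) * (rising n k * r !)
        ≡⟨ solve 4 (λ c d f r → (c :* d) :* (f :* r) := f :* (d :* (c :* r))) refl (1 + r) (2 + r) (rising n k) (r !) ⟩
      rising n k * (2 + r) !                               ≈⟨ rising-even≈ j (2 + r) n≡′ ⟩
      n !                                                  ∎
      where
      open ≈-Reasoning
      k = j + j
      n≡′ : n ≡ j + j + (2 + r)
      n≡′ = trans n≡ (solve 2 (λ j r → (con 1 :+ j) :+ (con 1 :+ j) :+ r := j :+ j :+ (con 2 :+ r)) refl j r)
      sum₁ : n + (2 + k) + (1 + r) ≡ p
      sum₁ = trans (solve 3 (λ n k r → n :+ (con 2 :+ k) :+ (con 1 :+ r) := con 1 :+ (n :+ (k :+ (con 2 :+ r)))) refl n k r)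
                   (trans (cong (λ m → suc (n + m)) (sym n≡′)) (sym p≡2n+1))
      sum₂ : n + (1 + k) + (2 + r) ≡ p
      sum₂ = trans (solve 3 (λ n k r → n :+ (con 1 :+ k) :+ (con 2 :+ r) := con 1 :+ (n :+ (k :+ (con 2 :+ r)))) refl n k r)
                   (trans (cong (λ m → suc (n + m)) (sym n≡′)) (sym p≡2n+1))

module _ (p : ℕ) .{{_ : NonZero p}} (p-prime : Prime p) {n m : ℕ} (p≡2n+1 : p ≡ suc (n + n)) (n≡2m : n ≡ m + m) where

  open Modular p
  open ≈-Reasoning

  half-factorial-sqrt-1 : n ! * n ! + 1 ≈ 0
  half-factorial-sqrt-1 = begin
    n ! * n ! + 1         ≈⟨ +-congʳ 1 (*-congʳ (n !) rising≈!) ⟨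
    rising n n * n ! + 1  ≡⟨ cong (_+ 1) (+-!≡rising*! n n) ⟨
    (n + n) ! + 1         ≡⟨ cong (λ k → k ! + 1) (cong (_∸ 1) p≡2n+1) ⟨
    (p ∸ 1) ! + 1         ≈⟨ +-congʳ 1 (Field.wilson p p-prime) ⟩
    p ∸ 1 + 1             ≡⟨ m∸n+n≡m (>-nonZero⁻¹ p) ⟩
    p                     ≈⟨ m+p≈m 0 ⟩
    0                     ∎
    where
    rising≈! : rising n n ≈ n !
    rising≈! = ≈-trans (≡⇒≈ (sym (*-identityʳ _)))
      (subst (λ k → rising n k * 1 ≈ n !) (sym n≡2m) (rising-even≈ p p≡2n+1 m 0 (trans n≡2m (sym (+-identityʳ _)))))

-- An odd modulus p = 2n + 1

module OddModulus (p : ℕ) .{{_ : NonZero p}} (n : ℕ) (p≡2n+1 : p ≡ suc (n + n)) where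

  open Modular p

  half≡n : (p ∸ 1) / 2 ≡ n
  half≡n = trans (cong (λ q → (q ∸ 1) / 2) p≡2n+1)
                 (trans (cong (_/ 2) (solve 1 (λ n → n :+ n := n :* con 2) refl n)) (m*n/n≡m n 2))
    where open +-*-Solver

  n<p : n < p
  n<p = subst (n <_) (sym p≡2n+1) (s≤s (m≤m+n n n))

  2*≡+ : ∀ z → 2 * z ≡ z + z
  2*≡+ z = cong (z +_) (+-identityʳ z)

  ≤n⇒+<p : ∀ {x y} → x ≤ n → y ≤ n → x + y < p
  ≤n⇒+<p x≤ y≤ = subst (_ <_) (sym p≡2n+1) (s≤s (+-mono-≤ x≤ y≤))

  >n⇒p<+ : ∀ {x y} → n < x → n < y → p < x + y
  >n⇒p<+ n<x n<y = subst (_< _) (sym p≡2n+1) (<-≤-trans (s≤s (+-monoʳ-< n (n<1+n n))) (+-mono-≤ n<x n<y))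

  ≤n⇒n<p∸ : ∀ {s} → s ≤ n → n < p ∸ s
  ≤n⇒n<p∸ {s} s≤ = +-cancelʳ-< s n (p ∸ s) (subst (n + s <_) (sym (m∸n+n≡m (<⇒≤ s<p))) (≤n⇒+<p ≤-refl s≤))
    where s<p = ≤-<-trans s≤ n<p

  fold : ℕ → ℕ
  fold z with z ≤? n
  ... | yes _ = z
  ... | no _  = p ∸ z

  fold-≤ : ∀ {z} → z ≤ n → fold z ≡ z
  fold-≤ {z} z≤ with z ≤? n
  ... | yes _   = refl
  ... | no z≰n = contradiction z≤ z≰n

  fold-> : ∀ {z} → n < z → fold z ≡ p ∸ z
  fold-> {z} n<z with z ≤? n
  ... | yes z≤ = contradiction z≤ (<⇒≱ n<z)
  ... | no _    = refl

  fold+≡p : ∀ {z} → n < z → z < p → fold z + z ≡ p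
  fold+≡p n<z z<p = trans (cong (_+ _) (fold-> n<z)) (m∸n+n≡m (<⇒≤ z<p))

  fold-range : ∀ {s} → 0 < s → s < p → 0 < fold s × fold s ≤ n
  fold-range {s} 0<s s<p with ≤-<-connex s n
  ... | inj₁ s≤  = subst (λ f → 0 < f × f ≤ n) (sym (fold-≤ s≤)) (0<s , s≤)
  ... | inj₂ n<s = subst (0 <_) (sym (fold-> n<s)) (m<n⇒0<n∸m s<p) ,
                   +-cancelʳ-≤ s (fold s) n (begin
                     fold s + s   ≡⟨ fold+≡p n<s s<p ⟩
                     p            ≡⟨ trans p≡2n+1 (sym (+-suc n n)) ⟩
                     n + suc n    ≤⟨ +-monoʳ-≤ n n<s ⟩
                     n + s        ∎)
    where open ≤-Reasoning

  fold-∸ : ∀ {s} → 0 < s → s < p → fold (p ∸ s) ≡ fold s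
  fold-∸ {s} 0<s s<p with ≤-<-connex s n
  ... | inj₁ s≤  = trans (fold-> (≤n⇒n<p∸ s≤)) (trans (m∸[m∸n]≡n (<⇒≤ s<p)) (sym (fold-≤ s≤)))
  ... | inj₂ n<s = trans (fold-≤ (subst (_≤ n) (fold-> n<s) (proj₂ (fold-range 0<s s<p)))) (sym (fold-> n<s))

  bigRes⇔ : ∀ x → bigRes p x ⇔ n < res p x
  bigRes⇔ x = mk⇔ (λ p<2r → ≰⇒> (λ r≤ → <-asym p<2r (subst (_< p) (sym (2*≡+ (res p x))) (≤n⇒+<p r≤ r≤))))
                  (λ n<r → subst (p <_) (sym (2*≡+ (res p x))) (>n⇒p<+ n<r n<r))

  tilde≡fold : ∀ x → tilde p x ≡ fold (res p x)
  tilde≡fold x with bigRes? p x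
  ... | yes p<2r = sym (fold-> (Equivalence.to (bigRes⇔ x) p<2r))
  ... | no ¬p<2r = sym (fold-≤ (≮⇒≥ (λ n<r → ¬p<2r (Equivalence.from (bigRes⇔ x) n<r))))

  fold-≡⇒≡∨complement : ∀ {s s′} → s < p → s′ < p → fold s ≡ fold s′ → s ≡ s′ ⊎ s + s′ ≡ p
  fold-≡⇒≡∨complement {s} {s′} s<p s′<p f≡f′ with ≤-<-connex s n | ≤-<-connex s′ n
  ... | inj₁ s≤  | inj₁ s′≤  = inj₁ (trans (sym (fold-≤ s≤)) (trans f≡f′ (fold-≤ s′≤)))
  ... | inj₁ s≤  | inj₂ n<s′ = inj₂ (trans (cong (_+ s′) (trans (sym (fold-≤ s≤)) f≡f′)) (fold+≡p n<s′ s′<p))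
  ... | inj₂ n<s | inj₁ s′≤  = inj₂ (trans (+-comm s s′)
                                 (trans (cong (_+ s) (trans (sym (fold-≤ s′≤)) (sym f≡f′))) (fold+≡p n<s s<p)))
  ... | inj₂ n<s | inj₂ n<s′ = inj₁ (+-cancelˡ-≡ (fold s) s s′
                                 (trans (fold+≡p n<s s<p) (trans (sym (fold+≡p n<s′ s′<p)) (cong (_+ s′) (sym f≡f′)))))

  fold-<-of-small-sum : ∀ {x y} → x < y → x + y < p → fold x < fold y
  fold-<-of-small-sum {x} {y} x<y x+y<p with ≤-<-connex x n | ≤-<-connex y n
  ... | inj₂ n<x | _        = contradiction (>n⇒p<+ n<x (<-trans n<x x<y)) (<⇒≯ x+y<p)
  ... | inj₁ x≤  | inj₁ y≤  = subst₂ _<_ (sym (fold-≤ x≤)) (sym (fold-≤ y≤)) x<y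
  ... | inj₁ x≤  | inj₂ n<y = subst (_< fold y) (sym (fold-≤ x≤))
      (+-cancelʳ-< y x (fold y) (subst (x + y <_) (sym (fold+≡p n<y y<p)) x+y<p))
    where y<p = ≤-<-trans (m≤n+m y x) x+y<p

  fold-<-of-large-sum : ∀ {x y} → x < y → y < p → p < x + y → fold y < fold x
  fold-<-of-large-sum {x} {y} x<y y<p p<x+y with ≤-<-connex x n | ≤-<-connex y n
  ... | _        | inj₁ y≤  = contradiction (≤n⇒+<p (<⇒≤ (<-≤-trans x<y y≤)) y≤) (<⇒≯ p<x+y)
  ... | inj₁ x≤  | inj₂ n<y = subst (fold y <_) (sym (fold-≤ x≤))
      (+-cancelʳ-< y (fold y) x (subst (_< x + y) (sym (fold+≡p n<y y<p)) p<x+y))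
  ... | inj₂ n<x | inj₂ n<y = +-cancelʳ-< y (fold y) (fold x)
      (subst (_< fold x + y) (sym (fold+≡p n<y y<p))
        (subst (_< fold x + y) (fold+≡p n<x (<-trans x<y y<p)) (+-monoʳ-< (fold x) x<y)))

  parity-double : ∀ y → parity (y + y) ≡ 0ℙ
  parity-double y = trans (ℙ.+-homo-+ y y) (ℙ.p+p≡0ℙ (parity y))

  parity-p : parity p ≡ 1ℙ
  parity-p = begin
    parity p              ≡⟨ cong parity p≡2n+1 ⟩
    parity (suc (n + n))  ≡⟨ ℙ.⁻¹-selfInverse (ℙ.suc-homo-⁻¹ (n + n)) ⟨
    parity (n + n) ⁻¹     ≡⟨ cong _⁻¹ (parity-double n) ⟩
    1ℙ                    ∎
    where open ≡-Reasoning

  parity-+p : ∀ a → parity (a + p) ≡ parity a ⁻¹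
  parity-+p a = trans (ℙ.+-homo-+ a p) (trans (cong (parity a ℙ.+_) parity-p) (ℙ.+-comm (parity a) 1ℙ))

  parity-complement : ∀ a b x → a + b ≡ p + (x + x) → parity a ≡ parity b ⁻¹
  parity-complement a b x a+b≡ = Equivalence.to (+≡1ℙ⇔≡⁻¹ (parity a) (parity b)) (begin
    parity a ℙ.+ parity b    ≡⟨ ℙ.+-homo-+ a b ⟨
    parity (a + b)           ≡⟨ cong parity (trans a+b≡ (+-comm p (x + x))) ⟩
    parity (x + x + p)       ≡⟨ parity-+p (x + x) ⟩
    parity (x + x) ⁻¹        ≡⟨ cong _⁻¹ (parity-double x) ⟩
    1ℙ                       ∎)
    where open ≡-Reasoning

  parity-equal : ∀ a b x → a + b ≡ x + x → parity a ≡ parity b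
  parity-equal a b x a+b≡ =
    +≡0ℙ⇒≡ (parity a) (parity b) (trans (sym (ℙ.+-homo-+ a b)) (trans (cong parity a+b≡) (parity-double x)))

  private
    D+[x+y] : ∀ D x {y z} → D + x ≡ z → D + (x + y) ≡ z + y
    D+[x+y] D x {y} D+x≡z = trans (sym (+-assoc D x y)) (cong (_+ y) D+x≡z)

    y+p+y≡y+y+p : ∀ y → y + p + y ≡ y + y + p
    y+p+y≡y+y+p y = trans (+-assoc y p y) (trans (cong (y +_) (+-comm p y)) (sym (+-assoc y y p)))

  -- For reduced residues x, y with D ≡ y − x and S ≡ x + y, the four cases are whether
  -- x < y and whether x + y < p: fold y < fold x exactly when these disagree, and
  -- exactly then D + S differs from 2 y by an odd multiple of p.
  fold-inversion⇔odd : ∀ {x y D S} → x < p → y < p → 0 < D → D < p → 0 < S → S < p →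
                       D + x ≈ y → S ≈ x + y → fold y < fold x ⇔ parity (D + S) ≡ 1ℙ
  fold-inversion⇔odd {x} {y} {D} {S} x<p y<p 0<D D<p 0<S S<p D+x≈y S≈x+y with <-cmp x y | <-cmp (x + y) p
  ... | tri≈ _ x≡y _ | _ = contradiction (≈⇒≡ D<p (>-nonZero⁻¹ p) (+-cancelʳ-≈ D 0 x (≈-trans D+x≈y (≡⇒≈ (sym x≡y))))) (>⇒≢ 0<D)
  ... | _ | tri≈ _ x+y≡p _ = contradiction (≈⇒≡ S<p (>-nonZero⁻¹ p) (≈-trans S≈x+y (≈-trans (≡⇒≈ x+y≡p) (m+p≈m 0)))) (>⇒≢ 0<S)
  ... | tri< x<y _ _ | tri< x+y<p _ _ = mk⇔
        (λ inv → contradiction inv (<-asym (fold-<-of-small-sum x<y x+y<p)))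
        (λ odd → contradiction (trans (sym even) odd) λ ())
    where
    even : parity (D + S) ≡ 0ℙ
    even = trans (cong parity (trans (cong (D +_) (≈⇒≡ S<p x+y<p S≈x+y)) (D+[x+y] D x (difference-≡ D<p x<y y<p D+x≈y)))) (parity-double y)
  ... | tri< x<y _ _ | tri> _ _ p<x+y = mk⇔ (λ _ → odd) (λ _ → fold-<-of-large-sum x<y y<p p<x+y)
    where
    odd : parity (D + S) ≡ 1ℙ
    odd = sym (ℙ.⁻¹-selfInverse (trans (sym (parity-+p (D + S)))
            (trans (cong parity (trans (+-assoc D S p) (trans (cong (D +_) (sum-wrap-≡ S<p x<p y<p p<x+y S≈x+y)) (D+[x+y] D x (difference-≡ D<p x<y y<p D+x≈y))))) (parity-double y))))
  ... | tri> _ _ y<x | tri< x+y<p _ _ = mk⇔ (λ _ → odd) (λ _ → fold-<-of-small-sum y<x (subst (_< p) (+-comm x y) x+y<p))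
    where
    odd : parity (D + S) ≡ 1ℙ
    odd = trans (cong parity (trans (cong (D +_) (≈⇒≡ S<p x+y<p S≈x+y)) (D+[x+y] D x (difference-wrap-≡ D<p y<x x<p D+x≈y))))
            (trans (cong parity (y+p+y≡y+y+p y)) (trans (parity-+p (y + y)) (cong _⁻¹ (parity-double y))))
  ... | tri> _ _ y<x | tri> _ _ p<x+y = mk⇔
        (λ inv → contradiction inv (<-asym (fold-<-of-large-sum y<x x<p (subst (p <_) (+-comm x y) p<x+y))))
        (λ odd → contradiction (trans (sym even) odd) λ ())
    where
    even : parity (D + S) ≡ 0ℙ
    even = trans (cong parity (+-cancelʳ-≡ p (D + S) (y + y)
             (trans (+-assoc D S p) (trans (cong (D +_) (sum-wrap-≡ S<p x<p y<p p<x+y S≈x+y)) (trans (D+[x+y] D x (difference-wrap-≡ D<p y<x x<p D+x≈y)) (y+p+y≡y+y+p y))))))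
             (parity-double y)

module _ (p : ℕ) .{{_ : NonZero p}} (n : ℕ) (p≡2n+1 : p ≡ suc (n + n)) where

  open OddModulus p n p≡2n+1
  open +-*-Solver

  diff-foldSum : ℕ × ℕ → ℕ × ℕ
  diff-foldSum (i , j) = j ∸ i , fold (i + j)

  private
    ∸+≡ : ∀ {i j} → i < j → j ∸ i + i ≡ j
    ∸+≡ i<j = m∸n+n≡m (<⇒≤ i<j)

    +≡∸+double : ∀ {i j} → i < j → i + j ≡ j ∸ i + (i + i)
    +≡∸+double {i} {j} i<j = trans (cong (i +_) (sym (∸+≡ i<j)))
                                   (solve 2 (λ d i → i :+ (d :+ i) := d :+ (i :+ i)) refl (j ∸ i) i)

    +<p : ∀ {i j} → PairLt n (i , j) → i + j < p
    +<p (_ , i<j , j≤n) = ≤n⇒+<p (<⇒≤ (<-≤-trans i<j j≤n)) j≤n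

  diff-foldSum-PairLt : ∀ {z} → PairLt n z → PairLt n (diff-foldSum z)
  diff-foldSum-PairLt {i , j} z@(0<i , i<j , j≤n) with ≤-<-connex (i + j) n
  ... | inj₁ s≤ = m<n⇒0<n∸m i<j ,
                  subst (j ∸ i <_) (sym (fold-≤ s≤)) (≤-<-trans (m∸n≤m j i) (m<n+m j 0<i)) ,
                  subst (_≤ n) (sym (fold-≤ s≤)) s≤
  ... | inj₂ n<s = m<n⇒0<n∸m i<j , d<f , proj₂ (fold-range (<-≤-trans 0<i (m≤m+n i j)) (+<p z))
    where
    d<f : j ∸ i < fold (i + j)
    d<f = +-cancelʳ-< (i + j) (j ∸ i) (fold (i + j)) (begin-strict
      j ∸ i + (i + j)   ≡⟨ +-assoc (j ∸ i) i j ⟨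
      j ∸ i + i + j     ≡⟨ cong (_+ j) (m∸n+n≡m (<⇒≤ i<j)) ⟩
      j + j             <⟨ ≤n⇒+<p j≤n j≤n ⟩
      p                 ≡⟨ fold+≡p n<s (+<p z) ⟨
      fold (i + j) + (i + j) ∎)
      where open ≤-Reasoning

  diff-foldSum-injective : ∀ {z z′} → PairLt n z → PairLt n z′ → diff-foldSum z ≡ diff-foldSum z′ → z ≡ z′
  diff-foldSum-injective {i , j} {i′ , j′} z@(_ , i<j , _) z′@(_ , i′<j′ , _) Φz≡Φz′
    with fold-≡⇒≡∨complement (+<p z) (+<p z′) (cong proj₂ Φz≡Φz′)
  ... | inj₁ s≡s′ = cong₂ _,_ i≡i′ (trans (sym (∸+≡ i<j)) (trans (cong₂ _+_ (cong proj₁ Φz≡Φz′) i≡i′) (∸+≡ i′<j′)))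
    where
    i≡i′ : i ≡ i′
    i≡i′ = double-injective (+-cancelˡ-≡ (j ∸ i) (i + i) (i′ + i′) (begin
      j ∸ i + (i + i)     ≡⟨ +≡∸+double i<j ⟨
      i + j               ≡⟨ s≡s′ ⟩
      i′ + j′             ≡⟨ +≡∸+double i′<j′ ⟩
      j′ ∸ i′ + (i′ + i′) ≡⟨ cong (_+ (i′ + i′)) (cong proj₁ Φz≡Φz′) ⟨
      j ∸ i + (i′ + i′)   ∎))
      where open ≡-Reasoning
  ... | inj₂ s+s′≡p = contradiction (begin
      1ℙ                         ≡⟨ parity-p ⟨
      parity p                   ≡⟨ cong parity s+s′≡p ⟨
      parity (i + j + (i′ + j′)) ≡⟨ cong parity (cong₂ _+_ (+≡∸+double i<j)
                                      (trans (+≡∸+double i′<j′) (cong (_+ (i′ + i′)) (sym (cong proj₁ Φz≡Φz′))))) ⟩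
      parity (d + (i + i) + (d + (i′ + i′)))
        ≡⟨ cong parity (solve 3 (λ d i i′ → d :+ (i :+ i) :+ (d :+ (i′ :+ i′)) := (d :+ i :+ i′) :+ (d :+ i :+ i′)) refl d i i′) ⟩
      parity ((d + i + i′) + (d + i + i′)) ≡⟨ parity-double (d + i + i′) ⟩
      0ℙ                         ∎) λ ()
    where
    open ≡-Reasoning
    d = j ∸ i

  diff-foldSum-onto : ∀ {w} → PairLt n w → ∃ λ z → PairLt n z × diff-foldSum z ≡ w
  diff-foldSum-onto {d , f} (0<d , d<f , f≤n) with even-or-odd (f ∸ d)
  ... | k , inj₁ f∸d≡2k = (k , d + k) , (0<k , m<n+m k 0<d , d+k≤n) , cong₂ _,_ (m+n∸n≡m d k) fold≡f
    where
    f≡ : d + (k + k) ≡ f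
    f≡ = trans (cong (d +_) (sym f∸d≡2k)) (m+[n∸m]≡n (<⇒≤ d<f))
    0<k : 0 < k
    0<k = n≢0⇒n>0 λ { refl → <-irrefl (trans (sym (+-identityʳ d)) f≡) d<f }
    d+k≤n : d + k ≤ n
    d+k≤n = ≤-trans (+-monoʳ-≤ d (m≤n+m k k)) (subst (_≤ n) (sym f≡) f≤n)
    fold≡f : fold (k + (d + k)) ≡ f
    fold≡f = trans (cong fold (trans (solve 2 (λ d k → k :+ (d :+ k) := d :+ (k :+ k)) refl d k) f≡)) (fold-≤ f≤n)
  ... | k , inj₂ f∸d≡2k+1 = (i , j) , (s≤s z≤n , m<n+m i 0<d , j≤n) , cong₂ _,_ (m+n∸n≡m d i) fold≡f
    where
    u = n ∸ f
    i = suc (k + u)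
    j = d + i
    f≡ : f ≡ d + suc (k + k)
    f≡ = trans (sym (m+[n∸m]≡n (<⇒≤ d<f))) (cong (d +_) f∸d≡2k+1)
    n≡ : n ≡ d + suc (k + k) + u
    n≡ = trans (sym (m+[n∸m]≡n f≤n)) (cong (_+ u) f≡)
    j≤n : j ≤ n
    j≤n = subst (j ≤_) (trans (solve 3 (λ d k u → d :+ (con 1 :+ (k :+ u)) :+ k := d :+ (con 1 :+ (k :+ k)) :+ u) refl d k u) (sym n≡))
                (m≤m+n j k)
    n<i+j : n < i + j
    n<i+j = subst (_< i + j) (sym n≡) (subst (d + suc (k + k) + u <_)
              (solve 3 (λ d k u → d :+ (con 1 :+ (k :+ k)) :+ u :+ (con 1 :+ u) := (con 1 :+ (k :+ u)) :+ (d :+ (con 1 :+ (k :+ u)))) refl d k u)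
              (m<m+n _ (s≤s z≤n)))
    f+[i+j]≡p : f + (i + j) ≡ p
    f+[i+j]≡p = begin
      f + (i + j)                  ≡⟨ cong (_+ (i + j)) f≡ ⟩
      d + suc (k + k) + (i + j)    ≡⟨ solve 3 (λ d k u → d :+ (con 1 :+ (k :+ k)) :+ ((con 1 :+ (k :+ u)) :+ (d :+ (con 1 :+ (k :+ u))))
                                         := con 1 :+ ((d :+ (con 1 :+ (k :+ k)) :+ u) :+ (d :+ (con 1 :+ (k :+ k)) :+ u))) refl d k u ⟩
      suc (m + m)                  ≡⟨ cong (λ m → suc (m + m)) (sym n≡) ⟩
      suc (n + n)                  ≡⟨ p≡2n+1 ⟨
      p                            ∎
      where
      open ≡-Reasoning
      m = d + suc (k + k) + u
    fold≡f : fold (i + j) ≡ f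
    fold≡f = trans (fold-> n<i+j) (trans (cong (_∸ (i + j)) (sym f+[i+j]≡p)) (m+n∸n≡m f (i + j)))

-- A square root of −1 modulo p

module SqrtMinusOne (p : ℕ) .{{_ : NonZero p}} (n : ℕ) (p≡2n+1 : p ≡ suc (n + n))
                    (t : ℕ) (t²+1≈0 : Modular._≈_ p (t * t + 1) 0) where

  open Modular p
  open OddModulus p n p≡2n+1

  r : ℕ → ℕ
  r k = t * k % p

  σ : ℕ → ℕ
  σ k = fold (r k)

  r<p : ∀ k → r k < p
  r<p k = m%n<n (t * k) p

  t*r+k≈0 : ∀ k → t * r k + k ≈ 0
  t*r+k≈0 k = begin
    t * r k + k         ≈⟨ +-congʳ k (*-congˡ t (m%p≈m (t * k))) ⟩
    t * (t * k) + k     ≡⟨ solve 2 (λ t k → t :* (t :* k) :+ k := (t :* t :+ con 1) :* k) refl t k ⟩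
    (t * t + 1) * k     ≈⟨ *-congʳ k t²+1≈0 ⟩
    0                   ∎
    where
    open ≈-Reasoning
    open +-*-Solver using (solve; _:+_; _:*_; _:=_; con)

  r-positive : ∀ {k} → 0 < k → k < p → 0 < r k
  r-positive {k} 0<k k<p = n≢0⇒n>0 λ rk≡0 → positive-≉0 0<k k<p (begin
    k                ≡⟨ cong (_+ k) (trans (sym (*-zeroʳ t)) (cong (t *_) (sym rk≡0))) ⟩
    t * r k + k      ≈⟨ t*r+k≈0 k ⟩
    0                ∎)
    where open ≈-Reasoning

  r∘r : ∀ {k} → 0 < k → k < p → r (r k) ≡ p ∸ k
  r∘r {k} 0<k k<p = +≈0⇒%≡∸ 0<k k<p (t*r+k≈0 k)

  r-∸ : ∀ {z} → 0 < z → z < p → r (p ∸ z) ≡ p ∸ r z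
  r-∸ {z} 0<z z<p = +≈0⇒%≡∸ (r-positive 0<z z<p) (r<p z) (begin
    t * (p ∸ z) + r z        ≈⟨ +-congˡ (t * (p ∸ z)) (m%p≈m (t * z)) ⟩
    t * (p ∸ z) + t * z      ≡⟨ *-distribˡ-+ t (p ∸ z) z ⟨
    t * (p ∸ z + z)          ≡⟨ cong (t *_) (m∸n+n≡m (<⇒≤ z<p)) ⟩
    t * p                    ≈⟨ kp≈0 t ⟩
    0                        ∎)
    where open ≈-Reasoning

  r∘σ-lower : ∀ {k} → 0 < k → k < p → r k ≤ n → r (σ k) ≡ p ∸ k
  r∘σ-lower 0<k k<p rk≤ = trans (cong r (fold-≤ rk≤)) (r∘r 0<k k<p)

  r∘σ-upper : ∀ {k} → 0 < k → k < p → n < r k → r (σ k) ≡ k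
  r∘σ-upper {k} 0<k k<p n<rk = begin
    r (fold (r k))    ≡⟨ cong r (fold-> n<rk) ⟩
    r (p ∸ r k)       ≡⟨ r-∸ (r-positive 0<k k<p) (r<p k) ⟩
    p ∸ r (r k)       ≡⟨ cong (p ∸_) (r∘r 0<k k<p) ⟩
    p ∸ (p ∸ k)       ≡⟨ m∸[m∸n]≡n (<⇒≤ k<p) ⟩
    k                 ∎
    where open ≡-Reasoning

  module _ {k : ℕ} (0<k : 0 < k) (k≤n : k ≤ n) where

    private
      k<p = ≤-<-trans k≤n n<p

    σ-range : 0 < σ k × σ k ≤ n
    σ-range = fold-range (r-positive 0<k k<p) (r<p k)

    σ-involutive : σ (σ k) ≡ k
    σ-involutive with ≤-<-connex (r k) n
    ... | inj₁ rk≤  = trans (cong fold (r∘σ-lower 0<k k<p rk≤)) (trans (fold-∸ 0<k k<p) (fold-≤ k≤n))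
    ... | inj₂ n<rk = trans (cong fold (r∘σ-upper 0<k k<p n<rk)) (fold-≤ k≤n)

    σ-swaps-upper : n < r (σ k) ⇔ (¬ n < r k)
    σ-swaps-upper with ≤-<-connex (r k) n
    ... | inj₁ rk≤  = mk⇔ (λ _ → ≤⇒≯ rk≤) (λ _ → subst (n <_) (sym (r∘σ-lower 0<k k<p rk≤)) (≤n⇒n<p∸ k≤n))
    ... | inj₂ n<rk = mk⇔ (λ n<rσk → contradiction (subst (n <_) (r∘σ-upper 0<k k<p n<rk) n<rσk) (≤⇒≯ k≤n))
                          (λ ¬n<rk → contradiction n<rk ¬n<rk)

  colour : ℕ → ℙ.Parity
  colour k = parity (k + r k)

  colour-σ : ∀ {k} → 0 < k → k ≤ n → colour (σ k) ≡ colour k ⁻¹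
  colour-σ {k} 0<k k≤n with ≤-<-connex (r k) n
  ... | inj₁ rk≤  = parity-complement (σ k + r (σ k)) (k + r k) (r k) (begin
    σ k + r (σ k) + (k + r k)     ≡⟨ cong₂ (λ a b → a + b + (k + r k)) (fold-≤ rk≤) (r∘σ-lower 0<k k<p rk≤) ⟩
    r k + (p ∸ k) + (k + r k)     ≡⟨ solve 3 (λ a b k → a :+ b :+ (k :+ a) := b :+ k :+ (a :+ a)) refl (r k) (p ∸ k) k ⟩
    p ∸ k + k + (r k + r k)       ≡⟨ cong (_+ (r k + r k)) (m∸n+n≡m (<⇒≤ k<p)) ⟩
    p + (r k + r k)               ∎)
    where
    open ≡-Reasoning
    open +-*-Solver using (solve; _:+_; _:=_)
    k<p = ≤-<-trans k≤n n<p
  ... | inj₂ n<rk = parity-complement (σ k + r (σ k)) (k + r k) k (begin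
    σ k + r (σ k) + (k + r k)     ≡⟨ cong (λ b → σ k + b + (k + r k)) (r∘σ-upper 0<k k<p n<rk) ⟩
    σ k + k + (k + r k)           ≡⟨ solve 3 (λ s k a → s :+ k :+ (k :+ a) := s :+ a :+ (k :+ k)) refl (σ k) k (r k) ⟩
    σ k + r k + (k + k)           ≡⟨ cong (_+ (k + k)) (fold+≡p n<rk (r<p k)) ⟩
    p + (k + k)                   ∎)
    where
    open ≡-Reasoning
    open +-*-Solver using (solve; _:+_; _:=_)
    k<p = ≤-<-trans k≤n n<p

  colour-fold : ∀ {s} → 0 < s → s < p → colour (fold s) ≡ colour s
  colour-fold {s} 0<s s<p with ≤-<-connex s n
  ... | inj₁ s≤  = cong colour (fold-≤ s≤)
  ... | inj₂ n<s = trans (cong colour (fold-> n<s)) (parity-equal (p ∸ s + r (p ∸ s)) (s + r s) p (begin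
    p ∸ s + r (p ∸ s) + (s + r s)      ≡⟨ cong (λ b → p ∸ s + b + (s + r s)) (r-∸ 0<s s<p) ⟩
    p ∸ s + (p ∸ r s) + (s + r s)      ≡⟨ solve 4 (λ a b c d → a :+ b :+ (c :+ d) := a :+ c :+ (b :+ d)) refl (p ∸ s) (p ∸ r s) s (r s) ⟩
    p ∸ s + s + (p ∸ r s + r s)        ≡⟨ cong₂ _+_ (m∸n+n≡m (<⇒≤ s<p)) (m∸n+n≡m (<⇒≤ (r<p s))) ⟩
    p + p                              ∎))
    where
    open ≡-Reasoning
    open +-*-Solver using (solve; _:+_; _:=_)

  inversion⇔bichromatic : ∀ {i j} → PairLt n (i , j) →
                          σ j < σ i ⇔ colour (j ∸ i) ℙ.+ colour (fold (i + j)) ≡ 1ℙ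
  inversion⇔bichromatic {i} {j} (0<i , i<j , j≤n) =
    mk⇔ (λ inv → trans colour-sum (Equivalence.to key inv)) (λ odd → Equivalence.from key (trans (sym colour-sum) odd))
    where
    d = j ∸ i
    s = i + j
    d+i≡j : d + i ≡ j
    d+i≡j = m∸n+n≡m (<⇒≤ i<j)
    j<p = ≤-<-trans j≤n n<p
    s<p : s < p
    s<p = ≤n⇒+<p (<⇒≤ (<-≤-trans i<j j≤n)) j≤n
    0<s : 0 < s
    0<s = <-≤-trans 0<i (m≤m+n i j)
    D+x≈y : r d + r i ≈ r j
    D+x≈y = begin
      r d + r i        ≈⟨ +-cong (m%p≈m (t * d)) (m%p≈m (t * i)) ⟩
      t * d + t * i    ≡⟨ *-distribˡ-+ t d i ⟨
      t * (d + i)      ≡⟨ cong (t *_) d+i≡j ⟩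
      t * j            ≈⟨ m%p≈m (t * j) ⟨
      r j              ∎
      where open ≈-Reasoning
    S≈x+y : r s ≈ r i + r j
    S≈x+y = begin
      r s              ≈⟨ m%p≈m (t * s) ⟩
      t * (i + j)      ≡⟨ *-distribˡ-+ t i j ⟩
      t * i + t * j    ≈⟨ +-cong (m%p≈m (t * i)) (m%p≈m (t * j)) ⟨
      r i + r j        ∎
      where open ≈-Reasoning
    key : σ j < σ i ⇔ parity (r d + r s) ≡ 1ℙ
    key = fold-inversion⇔odd (r<p i) (r<p j) (r-positive (m<n⇒0<n∸m i<j) (≤-<-trans (m∸n≤m j i) j<p)) (r<p d)
                             (r-positive 0<s s<p) (r<p s) D+x≈y S≈x+y
    colour-sum : colour d ℙ.+ colour (fold s) ≡ parity (r d + r s)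
    colour-sum = begin
      colour d ℙ.+ colour (fold s)     ≡⟨ cong (colour d ℙ.+_) (colour-fold 0<s s<p) ⟩
      colour d ℙ.+ colour s            ≡⟨ ℙ.+-homo-+ (d + r d) (s + r s) ⟨
      parity (d + r d + (s + r s))     ≡⟨ cong parity (solve 4 (λ d a s b → d :+ a :+ (s :+ b) := d :+ s :+ (a :+ b)) refl d (r d) s (r s)) ⟩
      parity (d + s + (r d + r s))     ≡⟨ cong (λ m → parity (m + (r d + r s))) (trans (sym (+-assoc d i j)) (cong (_+ j) d+i≡j)) ⟩
      parity (j + j + (r d + r s))     ≡⟨ ℙ.+-homo-+ (j + j) (r d + r s) ⟩
      parity (j + j) ℙ.+ parity (r d + r s) ≡⟨ cong (ℙ._+ parity (r d + r s)) (parity-double j) ⟩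
      parity (r d + r s)               ∎
      where
      open ≡-Reasoning
      open +-*-Solver using (solve; _:+_; _:=_)

  private
    σ-into : ∀ {k} → k ∈ range1 n → σ k ∈ range1 n
    σ-into k∈ = let 0<k , k≤n = ∈-range1⁻ n k∈ ; 0<σk , σk≤n = σ-range 0<k k≤n in ∈-range1⁺ n 0<σk σk≤n

    σ-involutive-on : ∀ {k} → k ∈ range1 n → σ (σ k) ≡ k
    σ-involutive-on k∈ = let 0<k , k≤n = ∈-range1⁻ n k∈ in σ-involutive 0<k k≤n

  Gamma≡count : Gamma t p ≡ count (λ k → bigRes? p (t * k)) (range1 n)
  Gamma≡count = cong (λ m → count (λ k → bigRes? p (t * k)) (range1 m)) half≡n

  Gamma+Gamma≡n : Gamma t p + Gamma t p ≡ n
  Gamma+Gamma≡n = begin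
    Gamma t p + Gamma t p  ≡⟨ cong₂ _+_ Gamma≡count Gamma≡count ⟩
    count big? (range1 n) + count big? (range1 n)
      ≡⟨ count-involution-swapping σ (Unique-range1 n) σ-into big? σ-involutive-on swaps ⟩
    length (range1 n)      ≡⟨ length-range1 n ⟩
    n                      ∎
    where
    open ≡-Reasoning
    big? = λ k → bigRes? p (t * k)
    swaps : ∀ {k} → k ∈ range1 n → bigRes p (t * σ k) ⇔ (¬ bigRes p (t * k))
    swaps {k} k∈ = let 0<k , k≤n = ∈-range1⁻ n k∈ ; swap = σ-swaps-upper 0<k k≤n in mk⇔
      (λ big-σk big-k → Equivalence.to swap (Equivalence.to (bigRes⇔ (t * σ k)) big-σk) (Equivalence.to (bigRes⇔ (t * k)) big-k))
      (λ ¬big-k → Equivalence.from (bigRes⇔ (t * σ k)) (Equivalence.from swap (λ n<rk → ¬big-k (Equivalence.from (bigRes⇔ (t * k)) n<rk))))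

  coloured-1ℙ-double : coloured colour 1ℙ n + coloured colour 1ℙ n ≡ n
  coloured-1ℙ-double = trans
    (count-involution-swapping σ (Unique-range1 n) σ-into (λ k → colour k ℙ.≟ 1ℙ) σ-involutive-on
      λ {k} k∈ → let 0<k , k≤n = ∈-range1⁻ n k∈ in
        subst (λ c → c ≡ 1ℙ ⇔ (¬ colour k ≡ 1ℙ)) (sym (colour-σ 0<k k≤n)) (⁻¹≡1ℙ⇔≢1ℙ (colour k)))
    (length-range1 n)

  coloured-0ℙ≡1ℙ : coloured colour 0ℙ n ≡ coloured colour 1ℙ n
  coloured-0ℙ≡1ℙ = +-cancelʳ-≡ (coloured colour 1ℙ n) _ _ (begin
    coloured colour 0ℙ n + coloured colour 1ℙ n
      ≡⟨ cong (_+ coloured colour 1ℙ n) (count-cong (λ k → colour k ℙ.≟ 0ℙ) (∁? (λ k → colour k ℙ.≟ 1ℙ)) (range1 n)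
            (λ {k} _ → ≡0ℙ⇔≢1ℙ (colour k))) ⟩
    count (∁? (λ k → colour k ℙ.≟ 1ℙ)) (range1 n) + coloured colour 1ℙ n
      ≡⟨ +-comm _ (coloured colour 1ℙ n) ⟩
    coloured colour 1ℙ n + count (∁? (λ k → colour k ℙ.≟ 1ℙ)) (range1 n)
      ≡⟨ count+count-∁ (λ k → colour k ℙ.≟ 1ℙ) (range1 n) ⟩
    length (range1 n)           ≡⟨ length-range1 n ⟩
    n                           ≡⟨ coloured-1ℙ-double ⟨
    coloured colour 1ℙ n + coloured colour 1ℙ n ∎)
    where open ≡-Reasoning

  Gamma≡coloured : Gamma t p ≡ coloured colour 1ℙ n
  Gamma≡coloured = double-injective (trans Gamma+Gamma≡n (sym coloured-1ℙ-double))

  gamma≡Gamma*Gamma : gamma t p ≡ Gamma t p * Gamma t p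
  gamma≡Gamma*Gamma = begin
    gamma t p
      ≡⟨ cong (λ m → count inversion? (pairsLt m)) half≡n ⟩
    count inversion? (pairsLt n)
      ≡⟨ count-cong inversion? (bichromatic? colour ∘ diff-foldSum p n p≡2n+1) (pairsLt n) inversion⇔ ⟩
    count (bichromatic? colour ∘ diff-foldSum p n p≡2n+1) (pairsLt n)
      ≡⟨ count-∘-bijection (diff-foldSum p n p≡2n+1) (Unique-pairsLt n) into (bichromatic? colour) injective onto ⟨
    count (bichromatic? colour) (pairsLt n)
      ≡⟨ count-bichromatic-pairsLt colour n ⟩
    coloured colour 0ℙ n * coloured colour 1ℙ n
      ≡⟨ cong₂ _*_ (trans coloured-0ℙ≡1ℙ (sym Gamma≡coloured)) (sym Gamma≡coloured) ⟩
    Gamma t p * Gamma t p ∎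
    where
    open ≡-Reasoning
    inversion? : (z : ℕ × ℕ) → Dec (tilde p (t * proj₂ z) < tilde p (t * proj₁ z))
    inversion? z = tilde p (t * proj₂ z) <? tilde p (t * proj₁ z)
    inversion⇔ : ∀ {z} → z ∈ pairsLt n → tilde p (t * proj₂ z) < tilde p (t * proj₁ z) ⇔
                 colour (proj₁ (diff-foldSum p n p≡2n+1 z)) ℙ.+ colour (proj₂ (diff-foldSum p n p≡2n+1 z)) ≡ 1ℙ
    inversion⇔ {i , j} z∈ = subst₂ (λ a b → a < b ⇔ colour (j ∸ i) ℙ.+ colour (fold (i + j)) ≡ 1ℙ) (sym (tilde≡fold (t * j))) (sym (tilde≡fold (t * i)))
                              (inversion⇔bichromatic (∈-pairsLt⁻ n z∈))
    into : ∀ {z} → z ∈ pairsLt n → diff-foldSum p n p≡2n+1 z ∈ pairsLt n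
    into z∈ = ∈-pairsLt⁺ n (diff-foldSum-PairLt p n p≡2n+1 (∈-pairsLt⁻ n z∈))
    injective : ∀ {z z′} → z ∈ pairsLt n → z′ ∈ pairsLt n → diff-foldSum p n p≡2n+1 z ≡ diff-foldSum p n p≡2n+1 z′ → z ≡ z′
    injective z∈ z′∈ = diff-foldSum-injective p n p≡2n+1 (∈-pairsLt⁻ n z∈) (∈-pairsLt⁻ n z′∈)
    onto : ∀ {w} → w ∈ pairsLt n → ∃ λ z → z ∈ pairsLt n × diff-foldSum p n p≡2n+1 z ≡ w
    onto w∈ = let z , pair , Φz≡w = diff-foldSum-onto p n p≡2n+1 (∈-pairsLt⁻ n w∈) in z , ∈-pairsLt⁺ n pair , Φz≡w

≡1[mod4]⇒≡4q+1 : ∀ p → p % 4 ≡ 1 → p ≡ suc ((p / 4 + p / 4) + (p / 4 + p / 4))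
≡1[mod4]⇒≡4q+1 p p%4≡1 = trans (m≡m%n+[m/n]*n p 4)
  (cong₂ _+_ p%4≡1 (solve 1 (λ q → q :* con 4 := (q :+ q) :+ (q :+ q)) refl (p / 4)))
  where open +-*-Solver

[q+q+[q+q]]/4≡q : ∀ q → (q + q + (q + q)) / 4 ≡ q
[q+q+[q+q]]/4≡q q = trans (cong (_/ 4) (solve 1 (λ q → (q :+ q) :+ (q :+ q) := q :* con 4) refl q)) (m*n/n≡m q 4)
  where open +-*-Solver

corollary3p4 : (p : ℕ) → .{{_ : NonZero p}} → Prime p → p % 4 ≡ 1 →
    Gamma (((p ∸ 1) / 2) !) p ≡ (p ∸ 1) / 4
      × gamma (((p ∸ 1) / 2) !) p ≡ ((p ∸ 1) / 4) ^ 2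
corollary3p4 p p-prime p%4≡1 =
  subst₂ (λ h q′ → Gamma (h !) p ≡ q′ × gamma (h !) p ≡ q′ ^ 2) (sym half≡n) (sym quarter≡q) (Gamma≡q , gamma≡q²)
  where
  q = p / 4
  n = q + q
  p≡2n+1 : p ≡ suc (n + n)
  p≡2n+1 = ≡1[mod4]⇒≡4q+1 p p%4≡1
  quarter≡q : (p ∸ 1) / 4 ≡ q
  quarter≡q = trans (cong (λ m → (m ∸ 1) / 4) p≡2n+1) ([q+q+[q+q]]/4≡q q)
  half≡n : (p ∸ 1) / 2 ≡ n
  half≡n = OddModulus.half≡n p n p≡2n+1
  open SqrtMinusOne p n p≡2n+1 (n !) (half-factorial-sqrt-1 p p-prime {m = q} p≡2n+1 refl)
  Gamma≡q : Gamma (n !) p ≡ q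
  Gamma≡q = double-injective Gamma+Gamma≡n
  gamma≡q² : gamma (n !) p ≡ q ^ 2
  gamma≡q² = trans gamma≡Gamma*Gamma (trans (cong₂ _*_ Gamma≡q Gamma≡q) (cong (q *_) (sym (*-identityʳ q))))
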